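{- Let $M$ be a regular matroid on $E$ with a triangulating circuit-cocircuit signature $(\sigma,\sigma^*)$. For any arc $\vec f$ and any $B_1,B_2\in\mathbf B(M)$, if $[\vec f]\cdot\beta_{(M,\sigma,\sigma^*)}(B_1)=\beta_{(M,\sigma,\sigma^*)}(B_2)$, then $[\vec f]\cdot\beta_{(M^*,\sigma^*,\sigma)}(E\setminus B_1)=\beta_{(M^*,\sigma^*,\sigma)}(E\setminus B_2)$.
   Context: $M=M(A)$ is represented by a real totally unimodular matrix $A$ of full row rank with columns indexed by $E$ (bases: index sets of nonsingular maximal square submatrices; circuits: minimal sets in no basis; cocircuits: minimal sets meeting every basis). A signed circuit (cocircuit) is an element of $\ker A$ (row space of $A$) with coefficients in $\{ -1,0,1\}$ whose support is a circuit (cocircuit); an arc is a 1-chain in $\mathbb Z^E$ with coefficients in $\{ -1,0,1\}$ and one-element support. The dual $M^*$ is the regular matroid on $E$ with bases $\{E\setminus B\}$, whose signed circuits are the signed cocircuits of $M$ and vice versa. An orientation is a map $E\to\{+,-\}$; $\vec P\sim\vec O$ means the sign of $\vec P(x)$ equals $\vec O(x)$ for $x$ in the support; $\mathrm{rev}_P(\vec O)$ flips $\vec O$ on $P$. For a matroid $N\in\{M,M^*\}$, circuit-cocircuit equivalence is generated by $\vec O\mapsto\mathrm{rev}_C(\vec O)$ for signed circuits/cocircuits $\vec C$ of $N$ with $\vec C\sim\vec O$; the sandpile group $\mathbb Z^E/(\Lambda+\Lambda^*)$ ($\Lambda,\Lambda^*$ generated by signed circuits, signed cocircuits — the same group for $M$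 and $M^*$) acts canonically: for an arc $\vec f$ and class $G$, pick $\vec O\in G$ with $-\vec f\sim\vec O$ and set $[\vec f]\cdot G=[\mathrm{rev}_{\{f\}}(\vec O)]$. A circuit signature $\tau$ picks one signed circuit $\tau(C)$ per circuit; cocircuit signatures likewise (so $\sigma^*$ is a circuit signature of $M^*$ and $\sigma$ a cocircuit signature of $M^*$). Fourientations are maps to subsets of $\{+,-\}$; $-\vec F$ swaps $+,-$; $\cap$ pointwise; a 1-chain is compatible with $\vec F$ if the sign of each nonzero coefficient at $x$ lies in $\vec F(x)$. For a basis $B$ of $N$: $\vec F(B,\tau)$ is $\{+,-\}$ on $B$ and at $x\notin B$ the sign of $\tau(C_x)(x)$ ($C_x$ the fundamental circuit); $\vec F(B,\tau^*)$ is $\{+,-\}$ off $B$ and at $x\in B$ the sign of $\tau^*(C^*_x)(x)$ ($C^*_x$ the fundamental cocircuit). $(\tau,\tau^*)$ is triangulating if for distinct bases $B_1,B_2$ no signed circuit is compatible with $\vec F(B_1,\tau)\cap-\vec F(B_2,\tau)$ and no signed cocircuit with $\vec F(B_1,\tau^*)\cap-\vec F(B_2,\tau^*)$; $(\sigma^*,\sigma)$ is then triangulating for $M^*$. An orientation is $(\tau,\tau^*)$-compatible if all compatible signed circuits lie in $\tau$ and all compatible signed cocircuits in $\tau^*$; each class has exactly one, $[\vec O]^\circ$, and $s\cdot\vec O:=(s\cdot[\vec O])^\circ$ for compatible $\vec O$. $\beta_{(N,\tau,\tau^*)}(B)=\vec F(B,\tau)\cap\vec F(B,\tau^*)$. 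-}

module Defs where

open import Level using (0ℓ)
open import Data.Nat as ℕ using (ℕ; zero; suc)
open import Data.Fin using (Fin; zero; suc; punchIn)
open import Data.Fin.Subset using (Subset; _∈_; _∉_; _⊆_; _⊂_; ∁; _∪_; _∩_; ⁅_⁆; Nonempty)
open import Data.Vec using (tabulate)
open import Data.Bool using (Bool; not; if_then_else_)
open import Data.Integer as ℤ using (ℤ; +_; -_; sign)
open import Data.Rational as ℚ using (ℚ)
open import Data.Sign using (Sign; opposite)
open import Data.Product using (Σ; ∃; ∃-syntax; _×_; _,_)
open import Data.Sum using (_⊎_)
open import Data.Empty using (⊥)
open import Function.Definitions using (Injective)
open import Function.Bundles using (_⇔_)
open import Relation.Nullary using (¬_; does)
open import Relation.Binary.PropositionalEquality using (_≡_; _≢_; _≗_)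
open import Relation.Binary.Construct.Closure.Equivalence using (EqClosure)

Matrix : Set → ℕ → ℕ → Set
Matrix X r n = Fin r → Fin n → X

sumℤ : ∀ {k} → (Fin k → ℤ) → ℤ
sumℤ {zero}  f = + 0
sumℤ {suc k} f = f zero ℤ.+ sumℤ (λ i → f (suc i))

sumℚ : ∀ {k} → (Fin k → ℚ) → ℚ
sumℚ {zero}  f = ℚ.0ℚ
sumℚ {suc k} f = f zero ℚ.+ sumℚ (λ i → f (suc i))

altSign : ∀ {k} → Fin k → ℤ
altSign zero    = + 1
altSign (suc j) = - altSign j

det : ∀ k → Matrix ℤ k k → ℤ
det zero    M = + 1
det (suc k) M =
  sumℤ (λ j → altSign j ℤ.* (M zero j ℤ.* det k (λ i l → M (suc i) (punchIn j l))))

TotallyUnimodular : ∀ {r n} → Matrix ℤ r n → Set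
TotallyUnimodular {r} {n} A =
  ∀ k (rows : Fin k → Fin r) (cols : Fin k → Fin n) →
  Injective _≡_ _≡_ rows → Injective _≡_ _≡_ cols →
  let d = det k (λ i j → A (rows i) (cols j)) in
  (d ≡ + 0) ⊎ (d ≡ + 1) ⊎ (d ≡ - (+ 1))

FullRowRank : ∀ {r n} → Matrix ℤ r n → Set
FullRowRank {r} {n} A =
  ∃[ cols ] (Injective _≡_ _≡_ cols × det r (λ i j → A i (cols j)) ≢ + 0)

Chain : ℕ → Set
Chain n = Fin n → ℤ

support : ∀ {n} → Chain n → Subset n
support v = tabulate (λ x → not (does (v x ℤ.≟ + 0)))

Ternary : ∀ {n} → Chain n → Set
Ternary v = ∀ x → (v x ≡ + 0) ⊎ (v x ≡ + 1) ⊎ (v x ≡ - (+ 1))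

Orientation : ℕ → Set
Orientation n = Fin n → Sign

-- a fourientation assigns to each element a subset of {+,-}
Fourientation : ℕ → Set₁
Fourientation n = Fin n → Sign → Set

_∩F_ : ∀ {n} → Fourientation n → Fourientation n → Fourientation n
(F ∩F G) x s = F x s × G x s

-F_ : ∀ {n} → Fourientation n → Fourientation n
(-F F) x s = F x (opposite s)

CompatF : ∀ {n} → Chain n → Fourientation n → Set
CompatF v F = ∀ x → v x ≢ + 0 → F x (sign (v x))

_∼_ : ∀ {n} → Chain n → Orientation n → Set
v ∼ O = ∀ x → v x ≢ + 0 → sign (v x) ≡ O x

rev : ∀ {n} → Chain n → Orientation n → Orientation n
rev v O x = if does (v x ℤ.≟ + 0) then O x else opposite (O x)

-- the orientation O "is" the fourientation F (F is single-valued, equal to O)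
Represents : ∀ {n} → Orientation n → Fourientation n → Set
Represents O F = ∀ x s → (O x ≡ s) ⇔ F x s

-- an arc: coefficient ±1 (given by the sign) at a single element
record Arc (n : ℕ) : Set where
  constructor arc
  field
    elem : Fin n
    sgn  : Sign

record MatroidData (n : ℕ) : Set₁ where
  field
    IsBasis  : Subset n → Set
    SCirc    : Chain n → Set
    SCocirc  : Chain n → Set

module _ {n : ℕ} (N : MatroidData n) where
  open MatroidData N

  Dependent : Subset n → Set
  Dependent C = ∀ B → IsBasis B → ¬ (C ⊆ B)

  IsCircuit : Subset n → Set
  IsCircuit C = Dependent C × (∀ D → D ⊂ C → ¬ Dependent D)

  Transversal : Subset n → Set
  Transversal C = ∀ B → IsBasis B → Nonempty (C ∩ B)

  IsCocircuit : Subset n → Set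
  IsCocircuit C = Transversal C × (∀ D → D ⊂ C → ¬ Transversal D)

  FundCircuit : Subset n → Fin n → Subset n → Set
  FundCircuit B x C = IsCircuit C × x ∈ C × C ⊆ (B ∪ ⁅ x ⁆)

  FundCocircuit : Subset n → Fin n → Subset n → Set
  FundCocircuit B x C = IsCocircuit C × x ∈ C × C ⊆ (∁ B ∪ ⁅ x ⁆)

  -- a circuit signature, given as the set of chosen signed circuits
  CircuitSignature : (Chain n → Set) → Set
  CircuitSignature τ =
    (∀ v → τ v → SCirc v) ×
    (∀ C → IsCircuit C → ∃[ v ] (τ v × support v ≡ C)) ×
    (∀ v w → τ v → τ w → support v ≡ support w → v ≗ w)

  CocircuitSignature : (Chain n → Set) → Set
  CocircuitSignature τ =
    (∀ v → τ v → SCocirc v) ×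
    (∀ C → IsCocircuit C → ∃[ v ] (τ v × support v ≡ C)) ×
    (∀ v w → τ v → τ w → support v ≡ support w → v ≗ w)

  Fcirc : (Chain n → Set) → Subset n → Fourientation n
  Fcirc τ B x s =
    x ∈ B ⊎ (x ∉ B × ∃[ v ] (τ v × FundCircuit B x (support v) × sign (v x) ≡ s))

  Fcocirc : (Chain n → Set) → Subset n → Fourientation n
  Fcocirc τ* B x s =
    x ∉ B ⊎ (x ∈ B × ∃[ v ] (τ* v × FundCocircuit B x (support v) × sign (v x) ≡ s))

  Triangulating : (Chain n → Set) → (Chain n → Set) → Set
  Triangulating τ τ* =
    ∀ B₁ B₂ → IsBasis B₁ → IsBasis B₂ → B₁ ≢ B₂ →
      (∀ v → SCirc v → ¬ CompatF v (Fcirc τ B₁ ∩F (-F Fcirc τ B₂))) ×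
      (∀ v → SCocirc v → ¬ CompatF v (Fcocirc τ* B₁ ∩F (-F Fcocirc τ* B₂)))

  β : (Chain n → Set) → (Chain n → Set) → Subset n → Fourientation n
  β τ τ* B = Fcirc τ B ∩F Fcocirc τ* B

  -- one generating step of circuit-cocircuit equivalence
  -- (pointwise equality of orientations is included since Agda lacks funext)
  ReverseStep : Orientation n → Orientation n → Set
  ReverseStep O O' =
    (O ≗ O') ⊎ ∃[ v ] ((SCirc v ⊎ SCocirc v) × v ∼ O × O' ≗ rev v O)

  CCEquiv : Orientation n → Orientation n → Set
  CCEquiv = EqClosure ReverseStep

  Compatible : (Chain n → Set) → (Chain n → Set) → Orientation n → Set
  Compatible τ τ* O =
    (∀ v → SCirc v → v ∼ O → τ v) × (∀ v → SCocirc v → v ∼ O → τ* v)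

  flipAt : Fin n → Orientation n → Orientation n
  flipAt e O x = if does (x Data.Fin.≟ e) then opposite (O x) else O x

  -- O' is a representative of the class [f]·[O]
  InActedClass : Arc n → Orientation n → Orientation n → Set
  InActedClass (arc e s) O O' =
    ∃[ O'' ] (CCEquiv O O'' × O'' e ≡ opposite s × CCEquiv (flipAt e O'') O')

  -- [f]·O = O'  (O' = ([f]·[O])°, the (τ,τ*)-compatible representative)
  Acts : (Chain n → Set) → (Chain n → Set) → Arc n → Orientation n → Orientation n → Set
  Acts τ τ* f O O' = Compatible τ τ* O' × InActedClass f O O'

module _ {r n : ℕ} (A : Matrix ℤ r n) where

  BasisOf : Subset n → Set
  BasisOf B = ∃[ cols ] (Injective _≡_ _≡_ cols ×
                         (∀ x → x ∈ B ⇔ (∃[ j ] cols j ≡ x)) ×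
                         det r (λ i j → A i (cols j)) ≢ + 0)

  InKernel : Chain n → Set
  InKernel v = ∀ i → sumℤ (λ j → A i j ℤ.* v j) ≡ + 0

  InRowSpace : Chain n → Set
  InRowSpace v = Σ (Fin r → ℚ) λ y → ∀ j → sumℚ (λ i → y i ℚ.* (A i j ℚ./ 1)) ≡ (v j ℚ./ 1)

  -- auxiliary: only the bases of M(A) (circuits/cocircuits are derived from bases alone)
  BasesOnly : MatroidData n
  BasesOnly = record { IsBasis = BasisOf ; SCirc = λ _ → ⊥ ; SCocirc = λ _ → ⊥ }

  M : MatroidData n
  M = record
    { IsBasis = BasisOf
    ; SCirc   = λ v → Ternary v × InKernel v × IsCircuit BasesOnly (support v)
    ; SCocirc = λ v → Ternary v × InRowSpace v × IsCocircuit BasesOnly (support v)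
    }

Dual : ∀ {n} → MatroidData n → MatroidData n
Dual N = record
  { IsBasis = λ B → MatroidData.IsBasis N (∁ B)
  ; SCirc   = MatroidData.SCocirc N
  ; SCocirc = MatroidData.SCirc N
  }

module Submission where

open import Defs
open import Data.Nat using (ℕ)
open import Data.Integer using (ℤ)
open import Data.Fin.Subset using (Subset; ∁)

open import Data.Fin.Subset using (_⊆_; _∪_; _∩_; ⁅_⁆; Nonempty)
open import Data.Fin.Subset.Properties
  using (x∈p⇒x∉∁p; x∉p⇒x∈∁p; x∈∁p⇒x∉p; x∈p∩q⁺; x∈p∩q⁻; nonempty?; ∪-∩-booleanAlgebra)
import Algebra.Lattice.Properties.BooleanAlgebra as BooleanAlgebraProperties
open import Data.Product using (_,_)
open import Data.Sum using (inj₁; inj₂)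
open import Function.Bundles using (Equivalence)
open import Relation.Nullary using (¬_; yes; no; contradiction)
open import Relation.Binary.PropositionalEquality using (_≡_; refl; sym; trans; subst; _≗_)
import Relation.Binary.Construct.Closure.Equivalence as EqClosure
open import Relation.Binary.Construct.Closure.ReflexiveTransitive using (_◅◅_)

-- Every ingredient of β, of circuit-cocircuit equivalence and of compatibility
-- is defined symmetrically in circuits and cocircuits, and complementing a
-- basis exchanges the two.  Hence β_{(M,σ,σ*)}(B) and β_{(M*,σ*,σ)}(E∖B) are
-- the same orientation, the equivalence relations of M and M* coincide, and a
-- (σ,σ*)-compatible orientation of M is (σ*,σ)-compatible in M*: the action of
-- [f] on the two sides is literally the same.

∁-involutive : ∀ {n} (p : Subset n) → ∁ (∁ p) ≡ p
∁-involutive {n} = BooleanAlgebraProperties.¬-involutive (∪-∩-booleanAlgebra n)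

⊈∁⇒∩-nonempty : ∀ {n} (D B : Subset n) → ¬ (D ⊆ ∁ B) → Nonempty (D ∩ B)
⊈∁⇒∩-nonempty D B D⊈∁B with nonempty? (D ∩ B)
... | yes D∩B≢∅ = D∩B≢∅
... | no  D∩B≡∅ =
  contradiction (λ {x} x∈D → x∉p⇒x∈∁p λ x∈B → D∩B≡∅ (x , x∈p∩q⁺ (x∈D , x∈B))) D⊈∁B

∩∁-nonempty⇒⊈ : ∀ {n} (D B : Subset n) → Nonempty (D ∩ ∁ B) → ¬ (D ⊆ B)
∩∁-nonempty⇒⊈ D B (x , x∈D∩∁B) D⊆B =
  let (x∈D , x∈∁B) = x∈p∩q⁻ D (∁ B) x∈D∩∁B in x∈∁p⇒x∉p x∈∁B (D⊆B x∈D)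

∼-resp-≗ : ∀ {n} {v : Chain n} {O O′ : Orientation n} → O ≗ O′ → v ∼ O → v ∼ O′
∼-resp-≗ O≗O′ v∼O x vx≢0 = trans (v∼O x vx≢0) (O≗O′ x)

Represents-⊆⇒≗ : ∀ {n} {O P : Orientation n} {F G : Fourientation n} →
                 Represents O F → Represents P G → (∀ x s → F x s → G x s) → P ≗ O
Represents-⊆⇒≗ {O = O} O≈F P≈G F⊆G x =
  Equivalence.from (P≈G x (O x)) (F⊆G x (O x) (Equivalence.to (O≈F x (O x)) refl))

module _ {n : ℕ} (N : MatroidData n) where
  open MatroidData N

  dependent⇒dual-transversal : ∀ D → Dependent N D → Transversal (Dual N) D
  dependent⇒dual-transversal D dep B B*-basis = ⊈∁⇒∩-nonempty D B (dep (∁ B) B*-basis)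

  transversal⇒dual-dependent : ∀ D → Transversal N D → Dependent (Dual N) D
  transversal⇒dual-dependent D tr B B*-basis = ∩∁-nonempty⇒⊈ D B (tr (∁ B) B*-basis)

  dual-dependent⇒transversal : ∀ D → Dependent (Dual N) D → Transversal N D
  dual-dependent⇒transversal D dep B B-basis =
    ⊈∁⇒∩-nonempty D B (dep (∁ B) (subst IsBasis (sym (∁-involutive B)) B-basis))

  dual-transversal⇒dependent : ∀ D → Transversal (Dual N) D → Dependent N D
  dual-transversal⇒dependent D tr B B-basis =
    ∩∁-nonempty⇒⊈ D B (tr (∁ B) (subst IsBasis (sym (∁-involutive B)) B-basis))

  circuit⇒dual-cocircuit : ∀ C → IsCircuit N C → IsCocircuit (Dual N) C
  circuit⇒dual-cocircuit C (dep , minimal) =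
    dependent⇒dual-transversal C dep ,
    λ D D⊂C tr → minimal D D⊂C (dual-transversal⇒dependent D tr)

  cocircuit⇒dual-circuit : ∀ C → IsCocircuit N C → IsCircuit (Dual N) C
  cocircuit⇒dual-circuit C (tr , minimal) =
    transversal⇒dual-dependent C tr ,
    λ D D⊂C dep → minimal D D⊂C (dual-dependent⇒transversal D dep)

  fundCircuit⇒dual-fundCocircuit : ∀ {B x C} → FundCircuit N B x C →
                                   FundCocircuit (Dual N) (∁ B) x C
  fundCircuit⇒dual-fundCocircuit {B} {x} {C} (circ , x∈C , C⊆B+x) =
    circuit⇒dual-cocircuit C circ , x∈C ,
    subst (λ B′ → C ⊆ B′ ∪ ⁅ x ⁆) (sym (∁-involutive B)) C⊆B+x

  fundCocircuit⇒dual-fundCircuit : ∀ {B x C} → FundCocircuit N B x C →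
                                   FundCircuit (Dual N) (∁ B) x C
  fundCocircuit⇒dual-fundCircuit {C = C} (cocirc , x∈C , C⊆∁B+x) =
    cocircuit⇒dual-circuit C cocirc , x∈C , C⊆∁B+x

  Fcirc⇒dual-Fcocirc : ∀ τ B x s → Fcirc N τ B x s → Fcocirc (Dual N) τ (∁ B) x s
  Fcirc⇒dual-Fcocirc τ B x s (inj₁ x∈B) = inj₁ (x∈p⇒x∉∁p x∈B)
  Fcirc⇒dual-Fcocirc τ B x s (inj₂ (x∉B , v , τv , fund , sign≡s)) =
    inj₂ (x∉p⇒x∈∁p x∉B , v , τv , fundCircuit⇒dual-fundCocircuit fund , sign≡s)

  Fcocirc⇒dual-Fcirc : ∀ τ* B x s → Fcocirc N τ* B x s → Fcirc (Dual N) τ* (∁ B) x s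
  Fcocirc⇒dual-Fcirc τ* B x s (inj₁ x∉B) = inj₁ (x∉p⇒x∈∁p x∉B)
  Fcocirc⇒dual-Fcirc τ* B x s (inj₂ (x∈B , v , τ*v , fund , sign≡s)) =
    inj₂ (x∈p⇒x∉∁p x∈B , v , τ*v , fundCocircuit⇒dual-fundCircuit fund , sign≡s)

  β⇒dual-β : ∀ τ τ* B x s → β N τ τ* B x s → β (Dual N) τ* τ (∁ B) x s
  β⇒dual-β τ τ* B x s (circ , cocirc) =
    Fcocirc⇒dual-Fcirc τ* B x s cocirc , Fcirc⇒dual-Fcocirc τ B x s circ

  reverseStep⇒dual : ∀ {O O′} → ReverseStep N O O′ → ReverseStep (Dual N) O O′
  reverseStep⇒dual (inj₁ O≗O′)                  = inj₁ O≗O′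
  reverseStep⇒dual (inj₂ (v , inj₁ circ , rest))   = inj₂ (v , inj₂ circ , rest)
  reverseStep⇒dual (inj₂ (v , inj₂ cocirc , rest)) = inj₂ (v , inj₁ cocirc , rest)

  ccEquiv⇒dual : ∀ {O O′} → CCEquiv N O O′ → CCEquiv (Dual N) O O′
  ccEquiv⇒dual = EqClosure.map reverseStep⇒dual

  compatible⇒dual : ∀ {τ τ* O} → Compatible N τ τ* O → Compatible (Dual N) τ* τ O
  compatible⇒dual (circ-in-τ , cocirc-in-τ*) = cocirc-in-τ* , circ-in-τ

  inActedClass⇒dual : ∀ {f O O′} → InActedClass N f O O′ → InActedClass (Dual N) f O O′
  inActedClass⇒dual {arc e s} (O″ , O~O″ , O″e≡-s , flipO″~O′) =
    O″ , ccEquiv⇒dual O~O″ , O″e≡-s , ccEquiv⇒dual flipO″~O′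

  acts⇒dual : ∀ {τ τ* f O O′} → Acts N τ τ* f O O′ → Acts (Dual N) τ* τ f O O′
  acts⇒dual (compat , acted) = compatible⇒dual compat , inActedClass⇒dual acted

  ≗⇒ccEquiv : ∀ {O O′} → O ≗ O′ → CCEquiv N O O′
  ≗⇒ccEquiv O≗O′ = EqClosure.return (inj₁ O≗O′)

  compatible-resp-≗ : ∀ {τ τ* O O′} → O ≗ O′ → Compatible N τ τ* O → Compatible N τ τ* O′
  compatible-resp-≗ O≗O′ (circ-in-τ , cocirc-in-τ*) =
    (λ v circ v∼O′ → circ-in-τ v circ (∼-resp-≗ (λ x → sym (O≗O′ x)) v∼O′)) ,
    (λ v cocirc v∼O′ → cocirc-in-τ* v cocirc (∼-resp-≗ (λ x → sym (O≗O′ x)) v∼O′))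

  inActedClass-resp-≗ : ∀ {f O O′ P P′} → P ≗ O → O′ ≗ P′ →
                        InActedClass N f O O′ → InActedClass N f P P′
  inActedClass-resp-≗ {arc e s} P≗O O′≗P′ (O″ , O~O″ , O″e≡-s , flipO″~O′) =
    O″ , ≗⇒ccEquiv P≗O ◅◅ O~O″ , O″e≡-s ,
    flipO″~O′ ◅◅ ≗⇒ccEquiv O′≗P′

  acts-resp-≗ : ∀ {τ τ* f O O′ P P′} → P ≗ O → P′ ≗ O′ →
                Acts N τ τ* f O O′ → Acts N τ τ* f P P′
  acts-resp-≗ P≗O P′≗O′ (compat , acted) =
    compatible-resp-≗ (λ x → sym (P′≗O′ x)) compat ,
    inActedClass-resp-≗ P≗O (λ x → sym (P′≗O′ x)) acted

corollary4p7 : ∀ {r n : ℕ} (A : Matrix ℤ r n) → TotallyUnimodular A → FullRowRank A →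
    (σ σ* : Chain n → Set) →
    CircuitSignature (M A) σ → CocircuitSignature (M A) σ* → Triangulating (M A) σ σ* →
    (f : Arc n) (B₁ B₂ : Subset n) →
    MatroidData.IsBasis (M A) B₁ → MatroidData.IsBasis (M A) B₂ →
    (O₁ O₂ P₁ P₂ : Orientation n) →
    Represents O₁ (β (M A) σ σ* B₁) → Represents O₂ (β (M A) σ σ* B₂) →
    Represents P₁ (β (Dual (M A)) σ* σ (∁ B₁)) → Represents P₂ (β (Dual (M A)) σ* σ (∁ B₂)) →
    Acts (M A) σ σ* f O₁ O₂ →
    Acts (Dual (M A)) σ* σ f P₁ P₂
corollary4p7 A _ _ σ σ* _ _ _ f B₁ B₂ _ _ O₁ O₂ P₁ P₂ O₁≈β₁ O₂≈β₂ P₁≈β₁* P₂≈β₂* acts =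
  acts-resp-≗ (Dual (M A)) P₁≗O₁ P₂≗O₂ (acts⇒dual (M A) acts)
  where
  P₁≗O₁ : P₁ ≗ O₁
  P₁≗O₁ = Represents-⊆⇒≗ O₁≈β₁ P₁≈β₁* (β⇒dual-β (M A) σ σ* B₁)

  P₂≗O₂ : P₂ ≗ O₂
  P₂≗O₂ = Represents-⊆⇒≗ O₂≈β₂ P₂≈β₂* (β⇒dual-β (M A) σ σ* B₂)
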